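{- Let $m,n,s,k,\lambda,t$ be positive integers. If there exists a simple ${}^{\lambda}\mathrm{H}_t(m,n;s,k)$, then there exists a $\left(\frac{2ms}{\lambda}+t,\,t,\,C_s,\,\lambda\right)$-difference family and a $\left(\frac{2nk}{\lambda}+t,\,t,\,C_k,\,\lambda\right)$-difference family.
   Context: A partially filled (p.f.) $m\times n$ array is an $m\times n$ matrix in which some cells may be empty. Let $t$ divide $\frac{2nk}{\lambda}$, put $v=\frac{2nk}{\lambda}+t$ and let $J$ be the subgroup of $\mathbb{Z}_v$ of order $t$. A $\lambda$-fold Heffter array over $\mathbb{Z}_v$ relative to $J$, denoted ${}^{\lambda}\mathrm{H}_t(m,n;s,k)$, is an $m\times n$ p.f. array with entries in $\mathbb{Z}_v$ such that: (a) each row has exactly $s$ filled cells and each column exactly $k$ filled cells; (b) the multiset $\{\pm x : x \text{ an entry of a filled cell}\}$ (with multiplicity over all filled cells) contains each element of $\mathbb{Z}_v\setminus J$ exactly $\lambda$ times; (c) the entries of every row and every column sum to $0$ in $\mathbb{Z}_v$. (Note $ms=nk$.) For a row (or column) with filled cells $b_1,\dots,b_\ell$, an ordering is a list $(x_1,\dots,x_\ell)$ of its entries obtained by traversing its filled cells according to a cyclic permutation of them; its partial sums are $s_i=x_1+\dots+x_i$; the ordering is simple if $s_1,\dots,s_\ell$ are pairwise distinct. The array is simple if every row and every column admits a simple ordering. For $t\mid v$, a $(v,t,C_\ell,\lambda)$-difference family is a collection $\mathcal F$ of cycles of length $\ell$ with vertices in $\mathbb{Z}_v$ such that, letting $J$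 be the subgroup of $\mathbb{Z}_v$ of order $t$, the multiset $\{\pm(x-y): \{x,y\}$ an edge of some cycle in $\mathcal F\}$ contains each element of $\mathbb{Z}_v\setminus J$ exactly $\lambda$ times and no element of $J$. -}

module Defs where

open import Data.Nat using (ℕ; zero; suc; _+_; _*_; _∸_; _%_)
open import Data.Nat.DivMod using (m%n<n)
open import Data.Nat.Divisibility using (_∣_)
open import Data.Fin using (Fin; toℕ; fromℕ<; _≟_)
open import Data.Maybe using (Maybe)
open import Data.List using (List; []; _∷_; [_]; _++_; map; catMaybes; concat; concatMap; length; filter; allFin)
open import Data.Nat.ListAction using (sum)
open import Data.List.Relation.Unary.Unique.Propositional using (Unique)
open import Data.List.Relation.Binary.Permutation.Propositional using (_↭_)
open import Data.Vec using (Vec; toList)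
open import Data.Product using (Σ; _×_; proj₁)
open import Relation.Nullary using (¬_)
open import Relation.Binary.PropositionalEquality using (_≡_)

-- Arithmetic in ℤ_v, with ℤ_v represented by Fin v (canonical residues)

infixl 6 _⊕_ _⊝_

_⊕_ : ∀ {v} → Fin v → Fin v → Fin v
_⊕_ {suc v} a b = fromℕ< (m%n<n (toℕ a + toℕ b) (suc v))

⊖_ : ∀ {v} → Fin v → Fin v
⊖_ {suc v} a = fromℕ< (m%n<n (suc v ∸ toℕ a) (suc v))

_⊝_ : ∀ {v} → Fin v → Fin v → Fin v
a ⊝ b = a ⊕ (⊖ b)

SumsToZero : ∀ {v} → List (Fin v) → Set
SumsToZero {v} xs = v ∣ sum (map toℕ xs)

-- x lies in the subgroup J of ℤ_v of order t, i.e. x is a multiple of v/t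
InJ : (v t : ℕ) → Fin v → Set
InJ v t x = Σ ℕ λ d → (d * t ≡ v) × (d ∣ toℕ x)

occ : ∀ {v} → Fin v → List (Fin v) → ℕ
occ y xs = length (filter (_≟ y) xs)

CoversOutsideJ : (v t l : ℕ) → List (Fin v) → Set
CoversOutsideJ v t l xs =
  (y : Fin v) → (InJ v t y → occ y xs ≡ 0) × (¬ InJ v t y → occ y xs ≡ l)

-- an m × n partially filled array over ℤ_v (nothing = empty cell)
PFArray : (m n v : ℕ) → Set
PFArray m n v = Fin m → Fin n → Maybe (Fin v)

module _ {m n v : ℕ} (A : PFArray m n v) where

  rowEntries : Fin m → List (Fin v)
  rowEntries i = catMaybes (map (A i) (allFin n))

  colEntries : Fin n → List (Fin v)
  colEntries j = catMaybes (map (λ i → A i j) (allFin m))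

  allEntries : List (Fin v)
  allEntries = concat (map rowEntries (allFin m))

  plusMinusEntries : List (Fin v)
  plusMinusEntries = concatMap (λ x → x ∷ (⊖ x) ∷ []) allEntries

partialSums : ∀ {v} → List (Fin v) → List (Fin v)
partialSums []       = []
partialSums (x ∷ xs) = go x xs
  where
  go : _ → List _ → List _
  go acc []       = acc ∷ []
  go acc (y ∷ ys) = acc ∷ go (acc ⊕ y) ys

-- An ordering of a row/column (traversal of its filled cells along a
-- cyclic permutation of them, starting at some cell) is a rearrangement
-- of its entries; it is simple if its partial sums are pairwise distinct.
HasSimpleOrdering : ∀ {v} → List (Fin v) → Set
HasSimpleOrdering {v} xs =
  Σ (List (Fin v)) λ ys → (ys ↭ xs) × Unique (partialSums ys)

record IsHeffter (m n s k l t v : ℕ) (A : PFArray m n v) : Set where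
  field
    rowFilled : (i : Fin m) → length (rowEntries A i) ≡ s
    colFilled : (j : Fin n) → length (colEntries A j) ≡ k
    covers    : CoversOutsideJ v t l (plusMinusEntries A)
    rowSum    : (i : Fin m) → SumsToZero (rowEntries A i)
    colSum    : (j : Fin n) → SumsToZero (colEntries A j)

record IsSimpleHeffter (m n s k l t v : ℕ) (A : PFArray m n v) : Set where
  field
    heffter   : IsHeffter m n s k l t v A
    rowSimple : (i : Fin m) → HasSimpleOrdering (rowEntries A i)
    colSimple : (j : Fin n) → HasSimpleOrdering (colEntries A j)

-- a cycle of length ℓ in ℤ_v: (x_1,...,x_ℓ) with pairwise distinct
-- vertices and edges {x_1,x_2},...,{x_{ℓ-1},x_ℓ},{x_ℓ,x_1}
Cycle : (v ℓ : ℕ) → Set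
Cycle v ℓ = Σ (Vec (Fin v) ℓ) λ xs → Unique (toList xs)

consecPairs : ∀ {A : Set} → List A → List (A × A)
consecPairs []           = []
consecPairs (x ∷ [])     = []
consecPairs (x ∷ y ∷ ys) = (x Data.Product., y) ∷ consecPairs (y ∷ ys)

cycleEdges : ∀ {A : Set} → List A → List (A × A)
cycleEdges []       = []
cycleEdges (x ∷ xs) = consecPairs (x ∷ xs ++ [ x ])

cycleDiffs : ∀ {v} → List (Fin v) → List (Fin v)
cycleDiffs xs = concatMap (λ e → (Data.Product.proj₁ e ⊝ Data.Product.proj₂ e)
                              ∷ (Data.Product.proj₂ e ⊝ Data.Product.proj₁ e) ∷ [])
                          (cycleEdges xs)

IsDiffFamily : (v t ℓ l : ℕ) → List (Cycle v ℓ) → Set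
IsDiffFamily v t ℓ l F =
  t ∣ v × CoversOutsideJ v t l (concatMap (λ C → cycleDiffs (toList (proj₁ C))) F)

DiffFamilyExists : (v t ℓ l : ℕ) → Set
DiffFamilyExists v t ℓ l = Σ (List (Cycle v ℓ)) λ F → IsDiffFamily v t ℓ l F

-- Traversing a row (or column) x₁,…,x_ℓ of a simple Heffter array in its simple
-- ordering and taking the partial sums s₁,…,s_ℓ yields a cycle (s₁,…,s_ℓ) in ℤ_v:
-- its vertices are distinct by simplicity, and since the line sums to zero we have
-- s_ℓ = 0, so its edge differences are ±x₂,…,±x_ℓ together with ±(s_ℓ − s₁) = ±x₁.
-- The cycles of all rows therefore have exactly the differences ±(entries), which
-- cover ℤ_v ∖ J λ times; the same holds for the columns, whose entries are those of
-- the rows rearranged. Counting the filled cells both ways gives ms = nk, so the two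
-- moduli 2ms/λ + t and 2nk/λ + t agree.
module Submission where

open import Defs
open import Data.Nat using (ℕ; zero; suc; _+_; _*_; _∸_; _%_; _/_; NonZero)
open import Data.Nat.Properties using (+-assoc; +-comm; +-identityʳ; *-assoc; m+[n∸m]≡n; <⇒≤)
open import Data.Nat.DivMod using (%-distribˡ-+; m%n%n≡m%n; m<n⇒m%n≡m; n%n≡0)
open import Data.Nat.Divisibility using (_∣_; n∣m⇒m%n≡0; ∣m∣n⇒∣m+n; ∣-refl)
open import Data.Nat.ListAction using (sum)
open import Data.Nat.ListAction.Properties using (sum-↭)
open import Data.Fin using (Fin; toℕ; _≟_) renaming (zero to 0F)
open import Data.Fin.Properties using (toℕ-fromℕ<; toℕ-injective; toℕ<n)
open import Data.List using (List; []; _∷_; [_]; _++_; map; concat; concatMap; foldl; length; allFin; mapMaybe; fromMaybe)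
open import Data.List.Properties
  using (++-assoc; ++-identityʳ; length-++; concatMap-++; concatMap-cong; length-tabulate; mapMaybe-concatMap)
open import Data.List.Relation.Unary.All using (All; []; _∷_; universal)
open import Data.List.Relation.Unary.All.Properties using (map⁺)
open import Data.List.Relation.Unary.Unique.Propositional using (Unique)
open import Data.List.Relation.Binary.Permutation.Propositional
  using (_↭_; prep; swap; ↭-refl; ↭-reflexive; ↭-sym; ↭-trans; module PermutationReasoning)
import Data.List.Relation.Binary.Permutation.Propositional as ↭
open import Data.List.Relation.Binary.Permutation.Propositional.Properties
  using (++⁺ˡ; ++⁺; shifts; ++-comm; ↭-length; filter-↭)
  renaming (map⁺ to ↭-map⁺)
open import Data.Vec using (Vec; toList; fromList)
open import Data.Vec.Properties using (toList∘fromList)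
open import Data.Product using (Σ; _×_; _,_; proj₁; proj₂)
open import Function using (id)
open import Algebra.Bundles using (AbelianGroup)
import Algebra.Properties.AbelianGroup
open import Relation.Binary.PropositionalEquality
  using (_≡_; refl; sym; trans; cong; cong₂; subst; isEquivalence; module ≡-Reasoning)

module _ {A B : Set} where

  concatMap⁺ : (f : A → List B) {xs ys : List A} → xs ↭ ys → concatMap f xs ↭ concatMap f ys
  concatMap⁺ f ↭.refl         = ↭-refl
  concatMap⁺ f (prep x p)     = ++⁺ˡ (f x) (concatMap⁺ f p)
  concatMap⁺ f (swap x y p)   = ↭-trans (shifts (f x) (f y)) (++⁺ˡ (f y) (++⁺ˡ (f x) (concatMap⁺ f p)))
  concatMap⁺ f (↭.trans p q)  = ↭-trans (concatMap⁺ f p) (concatMap⁺ f q)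

  concatMap-++-↭ : (f g : A → List B) (xs : List A) →
                   concatMap (λ x → f x ++ g x) xs ↭ concatMap f xs ++ concatMap g xs
  concatMap-++-↭ f g []       = ↭-refl
  concatMap-++-↭ f g (x ∷ xs) = begin
    (f x ++ g x) ++ concatMap (λ x → f x ++ g x) xs ≡⟨ ++-assoc (f x) (g x) _ ⟩
    f x ++ g x ++ concatMap (λ x → f x ++ g x) xs   ↭⟨ ++⁺ˡ (f x) (++⁺ˡ (g x) (concatMap-++-↭ f g xs)) ⟩
    f x ++ g x ++ concatMap f xs ++ concatMap g xs  ↭⟨ ++⁺ˡ (f x) (shifts (g x) (concatMap f xs)) ⟩
    f x ++ concatMap f xs ++ g x ++ concatMap g xs  ≡⟨ ++-assoc (f x) (concatMap f xs) _ ⟨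
    (f x ++ concatMap f xs) ++ g x ++ concatMap g xs ∎
    where open PermutationReasoning

  concatMap-const-[] : (xs : List A) → concatMap (λ _ → []) xs ≡ ([] {A = B})
  concatMap-const-[] []       = refl
  concatMap-const-[] (_ ∷ xs) = concatMap-const-[] xs

  length-concatMap-const : (f : A → List B) (c : ℕ) → (∀ x → length (f x) ≡ c) →
                           (xs : List A) → length (concatMap f xs) ≡ length xs * c
  length-concatMap-const f c h []       = refl
  length-concatMap-const f c h (x ∷ xs) =
    trans (length-++ (f x)) (cong₂ _+_ (h x) (length-concatMap-const f c h xs))

concatMap-interchange : {A B C : Set} (g : A → B → List C) (xs : List A) (ys : List B) →
                        concatMap (λ x → concatMap (g x) ys) xs ↭ concatMap (λ y → concatMap (λ x → g x y) xs) ys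
concatMap-interchange g []       ys = ↭-reflexive (sym (concatMap-const-[] ys))
concatMap-interchange g (x ∷ xs) ys =
  ↭-trans (++⁺ˡ (concatMap (g x) ys) (concatMap-interchange g xs ys))
          (↭-sym (concatMap-++-↭ (g x) (λ y → concatMap (λ x′ → g x′ y) xs) ys))

CoversOutsideJ-resp-↭ : ∀ {v t l} {xs ys : List (Fin v)} → xs ↭ ys →
                        CoversOutsideJ v t l ys → CoversOutsideJ v t l xs
CoversOutsideJ-resp-↭ {xs = xs} {ys} p cov y =
  (λ y∈J → trans occ-≡ (proj₁ (cov y) y∈J)) , (λ y∉J → trans occ-≡ (proj₂ (cov y) y∉J))
  where
  occ-≡ : occ y xs ≡ occ y ys
  occ-≡ = ↭-length (filter-↭ (_≟ y) p)

listToVec : {A : Set} {ℓ : ℕ} (xs : List A) → length xs ≡ ℓ → Σ (Vec A ℓ) λ u → toList u ≡ xs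
listToVec xs refl = fromList xs , toList∘fromList xs

length-partialSums : ∀ {v} (xs : List (Fin v)) → length (partialSums xs) ≡ length xs
length-partialSums []       = refl
length-partialSums (x ∷ xs) = length-partialSums-∷ x xs
  where
  length-partialSums-∷ : ∀ {v} (acc : Fin v) ys → length (partialSums (acc ∷ ys)) ≡ suc (length ys)
  length-partialSums-∷ acc []       = refl
  length-partialSums-∷ acc (y ∷ ys) = cong suc (length-partialSums-∷ (acc ⊕ y) ys)

module ℤ-mod (w : ℕ) where

  N : ℕ
  N = suc w

  [m%n+k]%n≡[m+k]%n : ∀ m k → (m % N + k) % N ≡ (m + k) % N
  [m%n+k]%n≡[m+k]%n m k = begin
    (m % N + k) % N         ≡⟨ %-distribˡ-+ (m % N) k N ⟩
    (m % N % N + k % N) % N ≡⟨ cong (λ z → (z + k % N) % N) (m%n%n≡m%n m N) ⟩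
    (m % N + k % N) % N     ≡⟨ %-distribˡ-+ m k N ⟨
    (m + k) % N             ∎
    where open ≡-Reasoning

  [m+k%n]%n≡[m+k]%n : ∀ m k → (m + k % N) % N ≡ (m + k) % N
  [m+k%n]%n≡[m+k]%n m k = begin
    (m + k % N) % N ≡⟨ cong (_% N) (+-comm m (k % N)) ⟩
    (k % N + m) % N ≡⟨ [m%n+k]%n≡[m+k]%n k m ⟩
    (k + m) % N     ≡⟨ cong (_% N) (+-comm k m) ⟩
    (m + k) % N     ∎
    where open ≡-Reasoning

  toℕ-⊕ : (a b : Fin N) → toℕ (a ⊕ b) ≡ (toℕ a + toℕ b) % N
  toℕ-⊕ a b = toℕ-fromℕ< _

  toℕ-⊖ : (a : Fin N) → toℕ (⊖ a) ≡ (N ∸ toℕ a) % N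
  toℕ-⊖ a = toℕ-fromℕ< _

  ⊕-assoc : (a b c : Fin N) → (a ⊕ b) ⊕ c ≡ a ⊕ (b ⊕ c)
  ⊕-assoc a b c = toℕ-injective (begin
    toℕ ((a ⊕ b) ⊕ c)                 ≡⟨ toℕ-⊕ (a ⊕ b) c ⟩
    (toℕ (a ⊕ b) + toℕ c) % N         ≡⟨ cong (λ z → (z + toℕ c) % N) (toℕ-⊕ a b) ⟩
    ((toℕ a + toℕ b) % N + toℕ c) % N ≡⟨ [m%n+k]%n≡[m+k]%n (toℕ a + toℕ b) (toℕ c) ⟩
    (toℕ a + toℕ b + toℕ c) % N       ≡⟨ cong (_% N) (+-assoc (toℕ a) (toℕ b) (toℕ c)) ⟩
    (toℕ a + (toℕ b + toℕ c)) % N     ≡⟨ [m+k%n]%n≡[m+k]%n (toℕ a) (toℕ b + toℕ c) ⟨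
    (toℕ a + (toℕ b + toℕ c) % N) % N ≡⟨ cong (λ z → (toℕ a + z) % N) (toℕ-⊕ b c) ⟨
    (toℕ a + toℕ (b ⊕ c)) % N         ≡⟨ toℕ-⊕ a (b ⊕ c) ⟨
    toℕ (a ⊕ (b ⊕ c))                 ∎)
    where open ≡-Reasoning

  ⊕-comm : (a b : Fin N) → a ⊕ b ≡ b ⊕ a
  ⊕-comm a b = toℕ-injective (begin
    toℕ (a ⊕ b)         ≡⟨ toℕ-⊕ a b ⟩
    (toℕ a + toℕ b) % N ≡⟨ cong (_% N) (+-comm (toℕ a) (toℕ b)) ⟩
    (toℕ b + toℕ a) % N ≡⟨ toℕ-⊕ b a ⟨
    toℕ (b ⊕ a)         ∎)
    where open ≡-Reasoning

  ⊕-identityˡ : (a : Fin N) → 0F ⊕ a ≡ a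
  ⊕-identityˡ a = toℕ-injective (trans (toℕ-⊕ 0F a) (m<n⇒m%n≡m (toℕ<n a)))

  ⊕-identityʳ : (a : Fin N) → a ⊕ 0F ≡ a
  ⊕-identityʳ a = trans (⊕-comm a 0F) (⊕-identityˡ a)

  ⊕-inverseʳ : (a : Fin N) → a ⊕ ⊖ a ≡ 0F
  ⊕-inverseʳ a = toℕ-injective (begin
    toℕ (a ⊕ ⊖ a)                 ≡⟨ toℕ-⊕ a (⊖ a) ⟩
    (toℕ a + toℕ (⊖ a)) % N       ≡⟨ cong (λ z → (toℕ a + z) % N) (toℕ-⊖ a) ⟩
    (toℕ a + (N ∸ toℕ a) % N) % N ≡⟨ [m+k%n]%n≡[m+k]%n (toℕ a) (N ∸ toℕ a) ⟩
    (toℕ a + (N ∸ toℕ a)) % N     ≡⟨ cong (_% N) (m+[n∸m]≡n (<⇒≤ (toℕ<n a))) ⟩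
    N % N                         ≡⟨ n%n≡0 N ⟩
    0                             ∎)
    where open ≡-Reasoning

  ⊕-⊖-abelianGroup : AbelianGroup _ _
  ⊕-⊖-abelianGroup = record
    { Carrier = Fin N
    ; _≈_ = _≡_
    ; _∙_ = _⊕_
    ; ε = 0F
    ; _⁻¹ = ⊖_
    ; isAbelianGroup = record
      { isGroup = record
        { isMonoid = record
          { isSemigroup = record
            { isMagma = record { isEquivalence = isEquivalence ; ∙-cong = cong₂ _⊕_ }
            ; assoc = ⊕-assoc
            }
          ; identity = ⊕-identityˡ , ⊕-identityʳ
          }
        ; inverse = (λ a → trans (⊕-comm (⊖ a) a) (⊕-inverseʳ a)) , ⊕-inverseʳ
        ; ⁻¹-cong = cong ⊖_
        }
      ; comm = ⊕-comm
      }
    }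

  toℕ-foldl-⊕ : (acc : Fin N) (ys : List (Fin N)) →
                toℕ (foldl _⊕_ acc ys) ≡ (toℕ acc + sum (map toℕ ys)) % N
  toℕ-foldl-⊕ acc []       = sym (trans (cong (_% N) (+-identityʳ (toℕ acc))) (m<n⇒m%n≡m (toℕ<n acc)))
  toℕ-foldl-⊕ acc (y ∷ ys) = begin
    toℕ (foldl _⊕_ (acc ⊕ y) ys)       ≡⟨ toℕ-foldl-⊕ (acc ⊕ y) ys ⟩
    (toℕ (acc ⊕ y) + S) % N            ≡⟨ cong (λ z → (z + S) % N) (toℕ-⊕ acc y) ⟩
    ((toℕ acc + toℕ y) % N + S) % N    ≡⟨ [m%n+k]%n≡[m+k]%n (toℕ acc + toℕ y) S ⟩
    (toℕ acc + toℕ y + S) % N          ≡⟨ cong (_% N) (+-assoc (toℕ acc) (toℕ y) S) ⟩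
    (toℕ acc + (toℕ y + S)) % N        ∎
    where
    open ≡-Reasoning
    S : ℕ
    S = sum (map toℕ ys)

  foldl-⊕-zeroSum : (x : Fin N) (xs : List (Fin N)) → SumsToZero (x ∷ xs) → foldl _⊕_ x xs ≡ 0F
  foldl-⊕-zeroSum x xs N∣sum = toℕ-injective (trans (toℕ-foldl-⊕ x xs) (n∣m⇒m%n≡0 _ N N∣sum))

±_ : ∀ {v} → Fin v → List (Fin v)
± x = x ∷ ⊖ x ∷ []

edgeDiffs : ∀ {v} → Fin v × Fin v → List (Fin v)
edgeDiffs (x , y) = (x ⊝ y) ∷ (y ⊝ x) ∷ []

familyDiffs : ∀ {v ℓ} → List (Cycle v ℓ) → List (Fin v)
familyDiffs = concatMap (λ C → cycleDiffs (toList (proj₁ C)))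

SimpleZeroSumLine : ∀ {v} → ℕ → List (Fin v) → Set
SimpleZeroSumLine ℓ xs = (length xs ≡ ℓ) × SumsToZero xs × HasSimpleOrdering xs

module PartialSumCycles (w : ℕ) where

  open ℤ-mod w
  open Algebra.Properties.AbelianGroup ⊕-⊖-abelianGroup using (xyx⁻¹≈y; ⁻¹-anti-homo-//)

  edgeDiffs-⊕ : (a y : Fin N) → edgeDiffs (a , a ⊕ y) ↭ ± y
  edgeDiffs-⊕ a y = ↭-trans (↭-reflexive (cong₂ (λ p q → p ∷ q ∷ []) a⊝[a⊕y]≡⊖y (xyx⁻¹≈y a y)))
                            (swap (⊖ y) y ↭-refl)
    where
    a⊝[a⊕y]≡⊖y : a ⊝ (a ⊕ y) ≡ ⊖ y
    a⊝[a⊕y]≡⊖y = trans (sym (⁻¹-anti-homo-// (a ⊕ y) a)) (cong ⊖_ (xyx⁻¹≈y a y))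

  consecPairs-partialSums : ∀ acc y ys (z : Fin N) →
    consecPairs (partialSums (acc ∷ y ∷ ys) ++ [ z ]) ≡ (acc , acc ⊕ y) ∷ consecPairs (partialSums (acc ⊕ y ∷ ys) ++ [ z ])
  consecPairs-partialSums acc y []       z = refl
  consecPairs-partialSums acc y (_ ∷ _) z = refl

  cycleEdges-partialSums : ∀ (x : Fin N) xs → cycleEdges (partialSums (x ∷ xs)) ≡ consecPairs (partialSums (x ∷ xs) ++ [ x ])
  cycleEdges-partialSums x []      = refl
  cycleEdges-partialSums x (_ ∷ _) = refl

  pathDiffs-partialSums : ∀ acc ys (z : Fin N) →
    concatMap edgeDiffs (consecPairs (partialSums (acc ∷ ys) ++ [ z ]))
      ↭ concatMap ±_ ys ++ edgeDiffs (foldl _⊕_ acc ys , z)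
  pathDiffs-partialSums acc []       z = ↭-reflexive (++-identityʳ _)
  pathDiffs-partialSums acc (y ∷ ys) z
    rewrite consecPairs-partialSums acc y ys z
    = ++⁺ (edgeDiffs-⊕ acc y) (pathDiffs-partialSums (acc ⊕ y) ys z)

  cycleDiffs-partialSums : (xs : List (Fin N)) → SumsToZero xs → cycleDiffs (partialSums xs) ↭ concatMap ±_ xs
  cycleDiffs-partialSums []       _      = ↭-refl
  cycleDiffs-partialSums (x ∷ xs) N∣sum = begin
    cycleDiffs (partialSums (x ∷ xs))
      ≡⟨ cong (concatMap edgeDiffs) (cycleEdges-partialSums x xs) ⟩
    concatMap edgeDiffs (consecPairs (partialSums (x ∷ xs) ++ [ x ]))
      ↭⟨ pathDiffs-partialSums x xs x ⟩
    concatMap ±_ xs ++ edgeDiffs (foldl _⊕_ x xs , x)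
      ≡⟨ cong₂ (λ s u → concatMap ±_ xs ++ edgeDiffs (s , u)) (foldl-⊕-zeroSum x xs N∣sum) (sym (⊕-identityˡ x)) ⟩
    concatMap ±_ xs ++ edgeDiffs (0F , 0F ⊕ x)
      ↭⟨ ++⁺ˡ (concatMap ±_ xs) (edgeDiffs-⊕ 0F x) ⟩
    concatMap ±_ xs ++ ± x
      ↭⟨ ++-comm (concatMap ±_ xs) (± x) ⟩
    concatMap ±_ (x ∷ xs) ∎
    where open PermutationReasoning

  partialSumCycle : ∀ {ℓ} (xs : List (Fin N)) → SimpleZeroSumLine ℓ xs →
                    Σ (Cycle N ℓ) λ C → cycleDiffs (toList (proj₁ C)) ↭ concatMap ±_ xs
  partialSumCycle xs (length≡ℓ , N∣sum , ys , ys↭xs , distinct)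
    with listToVec (partialSums ys) (trans (length-partialSums ys) (trans (↭-length ys↭xs) length≡ℓ))
  ... | vertices , vertices≡ =
      (vertices , subst Unique (sym vertices≡) distinct)
    , ↭-trans (↭-reflexive (cong cycleDiffs vertices≡))
              (↭-trans (cycleDiffs-partialSums ys N∣sum′) (concatMap⁺ ±_ ys↭xs))
    where
    N∣sum′ : SumsToZero ys
    N∣sum′ = subst (N ∣_) (sym (sum-↭ (↭-map⁺ toℕ ys↭xs))) N∣sum

  partialSumCycles : ∀ {ℓ} (lines : List (List (Fin N))) → All (SimpleZeroSumLine ℓ) lines →
                     Σ (List (Cycle N ℓ)) λ F → familyDiffs F ↭ concatMap ±_ (concat lines)
  partialSumCycles []           []       = [] , ↭-refl
  partialSumCycles {ℓ} (xs ∷ lines) (p ∷ ps) =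
      (proj₁ C ∷ proj₁ F)
    , ↭-trans (++⁺ (proj₂ C) (proj₂ F)) (↭-reflexive (sym (concatMap-++ ±_ xs (concat lines))))
    where
    C : Σ (Cycle N ℓ) λ C → cycleDiffs (toList (proj₁ C)) ↭ concatMap ±_ xs
    C = partialSumCycle xs p
    F : Σ (List (Cycle N ℓ)) λ F → familyDiffs F ↭ concatMap ±_ (concat lines)
    F = partialSumCycles lines ps

diffFamily-fromLines : ∀ {v} t ℓ l → t ∣ v → (lines : List (List (Fin v))) → All (SimpleZeroSumLine ℓ) lines →
                       CoversOutsideJ v t l (concatMap ±_ (concat lines)) → DiffFamilyExists v t ℓ l
diffFamily-fromLines {zero}  t ℓ l t∣v lines ps cov = [] , t∣v , λ ()
diffFamily-fromLines {suc w} t ℓ l t∣v lines ps cov =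
  proj₁ F , t∣v , CoversOutsideJ-resp-↭ (proj₂ F) cov
  where
  F : Σ (List (Cycle (suc w) ℓ)) λ F → familyDiffs F ↭ concatMap ±_ (concat lines)
  F = PartialSumCycles.partialSumCycles w lines ps

module _ {m n v : ℕ} (A : PFArray m n v) where

  allEntries-↭-colEntries : allEntries A ↭ concatMap (colEntries A) (allFin n)
  allEntries-↭-colEntries = begin
    concatMap (λ i → mapMaybe (A i) (allFin n)) (allFin m)
      ≡⟨ concatMap-cong (λ i → mapMaybe-concatMap (A i) (allFin n)) (allFin m) ⟩
    concatMap (λ i → concatMap (λ j → fromMaybe (A i j)) (allFin n)) (allFin m)
      ↭⟨ concatMap-interchange (λ i j → fromMaybe (A i j)) (allFin m) (allFin n) ⟩
    concatMap (λ j → concatMap (λ i → fromMaybe (A i j)) (allFin m)) (allFin n)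
      ≡⟨ concatMap-cong (λ j → mapMaybe-concatMap (λ i → A i j) (allFin m)) (allFin n) ⟨
    concatMap (λ j → mapMaybe (λ i → A i j) (allFin m)) (allFin n) ∎
    where open PermutationReasoning

module _ {m n s k l t v : ℕ} {A : PFArray m n v} (H : IsSimpleHeffter m n s k l t v A) where

  open IsSimpleHeffter H
  open IsHeffter heffter

  m*s≡n*k : m * s ≡ n * k
  m*s≡n*k = begin
    m * s                                          ≡⟨ cong (_* s) (length-tabulate (id {A = Fin m})) ⟨
    length (allFin m) * s                          ≡⟨ length-concatMap-const (rowEntries A) s rowFilled (allFin m) ⟨
    length (allEntries A)                          ≡⟨ ↭-length (allEntries-↭-colEntries A) ⟩
    length (concatMap (colEntries A) (allFin n))   ≡⟨ length-concatMap-const (colEntries A) k colFilled (allFin n) ⟩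
    length (allFin n) * k                          ≡⟨ cong (_* k) (length-tabulate (id {A = Fin n})) ⟩
    n * k                                          ∎
    where open ≡-Reasoning

  rowDiffFamily : t ∣ v → DiffFamilyExists v t s l
  rowDiffFamily t∣v = diffFamily-fromLines t s l t∣v (map (rowEntries A) (allFin m))
    (map⁺ (universal (λ i → rowFilled i , rowSum i , rowSimple i) (allFin m))) covers

  colDiffFamily : t ∣ v → DiffFamilyExists v t k l
  colDiffFamily t∣v = diffFamily-fromLines t k l t∣v (map (colEntries A) (allFin n))
    (map⁺ (universal (λ j → colFilled j , colSum j , colSimple j) (allFin n)))
    (CoversOutsideJ-resp-↭ (concatMap⁺ ±_ (↭-sym (allEntries-↭-colEntries A))) covers)

proposition3p6 : (m n s k l t : ℕ)
    → .{{_ : NonZero m}} → .{{_ : NonZero n}} → .{{_ : NonZero s}}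
    → .{{_ : NonZero k}} → .{{_ : NonZero l}} → .{{_ : NonZero t}}
    → l ∣ 2 * n * k → t ∣ 2 * n * k / l
    → Σ (PFArray m n (2 * n * k / l + t)) (λ A → IsSimpleHeffter m n s k l t (2 * n * k / l + t) A)
    → DiffFamilyExists (2 * m * s / l + t) t s l × DiffFamilyExists (2 * n * k / l + t) t k l
proposition3p6 m n s k l t _ t∣2nk/l (A , H) =
  subst (λ v → DiffFamilyExists v t s l) (sym same-modulus) (rowDiffFamily H t∣v) , colDiffFamily H t∣v
  where
  t∣v : t ∣ 2 * n * k / l + t
  t∣v = ∣m∣n⇒∣m+n t∣2nk/l ∣-refl
  same-modulus : 2 * m * s / l + t ≡ 2 * n * k / l + t
  same-modulus = cong (λ z → z / l + t)
    (trans (*-assoc 2 m s) (trans (cong (2 *_) (m*s≡n*k H)) (sym (*-assoc 2 n k))))
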